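{- Let $k$ be a positive integer, let $c(n,k)$ be defined by $(1-k^2x)^{ -1/k}=\sum_{n\ge 0}c(n,k)x^n$, and let $p$ be a prime not dividing $k$. Write $n=\sum_{m\ge0}a_mp^m$ in base $p$ (digits $0\le a_m\le p-1$, all but finitely many zero), and write the $p$-adic integer $1/k$ as $1/k=1+\sum_{m\ge 0}b_mp^m$ with digits $0\le b_m\le p-1$. Then $\nu_p(c(n,k))$ equals the number of indices $m\ge 0$ such that either (i) $a_m+b_m\ge p$, or (ii) there is $j\le m$ such that $a_{m-i}+b_{m-i}=p-1$ for all $0\le i\le j-1$ and $a_{m-j}+b_{m-j}\ge p$.
   Context: $\nu_p(N)$ denotes the exponent of the highest power of $p$ dividing the integer $N$. Since $p\nmid k$, $1/k-1$ is a $p$-adic integer and the $b_m$ are its $p$-adic digits. -}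

module Defs where

open import Data.Nat as ℕ using (ℕ; zero; suc; _^_; _∸_; _≤_; _<_; NonZero)
open import Data.Nat.Properties using (m^n≢0)
open import Data.Nat.DivMod using (_/_; _%_)
open import Data.Nat.Divisibility using (_∣_)
open import Data.Integer as ℤ using (ℤ; +_; ∣_∣)
open import Data.Rational as ℚ using (ℚ; 0ℚ; 1ℚ)
open import Data.Bool using (Bool; true; false; _∧_; _∨_; if_then_else_)
open import Data.Product using (Σ; _×_)
open import Relation.Nullary using (¬_)
open import Relation.Binary.PropositionalEquality using (_≡_)

ℕ→ℚ : ℕ → ℚ
ℕ→ℚ n = (+ n) ℚ./ 1

_^ℚ_ : ℚ → ℕ → ℚ
q ^ℚ zero = 1ℚ
q ^ℚ suc n = q ℚ.* (q ^ℚ n)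

gbinom : ℚ → ℕ → ℚ
gbinom α zero = 1ℚ
gbinom α (suc n) = gbinom α n ℚ.* (α ℚ.- ℕ→ℚ n) ℚ.* ((+ 1) ℚ./ suc n)

-- c(n,k): coefficient of x^n in (1 - k^2 x)^(-1/k) = Σ binom(-1/k, n) (-k^2 x)^n
c : (n k : ℕ) → .{{NonZero k}} → ℚ
c n k = gbinom (ℚ.- ((+ 1) ℚ./ k)) n ℚ.* ((ℚ.- ℕ→ℚ (k ℕ.* k)) ^ℚ n)

-- ν_p(r) = N for a nonzero rational r:  r = p^N * u / v  with p ∤ u, p ∤ v
ValP : ℕ → ℕ → ℚ → Set
ValP p N r = Σ ℤ λ u → Σ ℕ λ v →
  (¬ (p ∣ ∣ u ∣)) × (¬ (p ∣ suc v)) ×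
  (r ℚ.* ℕ→ℚ (suc v) ≡ ((+ (p ^ N)) ℤ.* u) ℚ./ 1)

sumBelow : ℕ → (ℕ → ℕ) → ℕ
sumBelow zero f = 0
sumBelow (suc M) f = sumBelow M f ℕ.+ f M

countBelow : ℕ → (ℕ → Bool) → ℕ
countBelow zero P = 0
countBelow (suc B) P = countBelow B P ℕ.+ (if P B then 1 else 0)

anyUpTo : ℕ → (ℕ → Bool) → Bool
anyUpTo zero P = P 0
anyUpTo (suc m) P = anyUpTo m P ∨ P (suc m)

allBelow : ℕ → (ℕ → Bool) → Bool
allBelow zero P = true
allBelow (suc j) P = allBelow j P ∧ P j

digit : (p : ℕ) → .{{NonZero p}} → ℕ → ℕ → ℕ
digit p n m = (n / (p ^ m)) {{m^n≢0 p m}} % p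

-- The condition on index m: there is j ≤ m with a_{m-i}+b_{m-i} = p-1 for all i < j
-- and a_{m-j}+b_{m-j} ≥ p.  (j = 0 is condition (i).)
condM : (p : ℕ) → (a b : ℕ → ℕ) → ℕ → Bool
condM p a b m = anyUpTo m λ j →
  allBelow j (λ i → (a (m ∸ i) ℕ.+ b (m ∸ i)) ℕ.≡ᵇ (p ∸ 1))
  ∧ (p ℕ.≤ᵇ (a (m ∸ j) ℕ.+ b (m ∸ j)))

module Submission where

-- Proof idea (a Kummer-type count of carries).
--
-- Let K(n) = ∏_{i<n} k(1+ik).  Expanding the generalised binomial coefficient gives
-- c(n,k)·n! = K(n), so ν_p(c(n,k)) = ν_p(K(n)) − ν_p(n!) = Σ_{i<n} (ν_p(1+ik) − ν_p(i+1))
-- because p ∤ k.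
-- Put β_M = Σ_{m<M} b_m p^m; the hypothesis says k(1+β_M) ≡ 1 (mod p^M).  Call m a
-- carry of n when p^{m+1} ≤ (n mod p^{m+1}) + β_{m+1}, i.e. adding n and β in base p
-- carries out of digit m.  For each level Q = p^{m+1} one has
--     [m is a carry of n] + [Q ∣ 1+nk] = [m is a carry of n+1] + [Q ∣ n+1],
-- because Q ∣ 1+nk iff (n mod Q) + β_{m+1} + 1 = Q.  Summing over m and telescoping
-- from 0 to n, the number of carries of n is Σ_{i<n} (ν_p(1+ik) − ν_p(i+1)), which is
-- ν_p(c(n,k)).  Carries obey the recursion "digit sum ≥ p, or digit sum = p−1
-- and the previous position carries", which is also the recursion of the condition
-- condM of the statement, so both count the same positions; all of them lie below kn.

open import Defs
open import Data.Bool using (Bool; true; _∧_; _∨_; if_then_else_)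
open import Data.Bool.Properties using (T-≡; ∨-assoc; ∧-assoc; ∧-identityʳ; ∧-distribˡ-∨)
open import Data.Empty using (⊥-elim)
import Data.Integer as ℤ
import Data.Integer.Properties as ℤP
open import Data.Nat using (ℕ; zero; suc; NonZero; _+_; _*_; _^_; _∸_; _<_; _≤_; _⊓_; _!; z≤n; s≤s; _≤ᵇ_; _<ᵇ_; _≡ᵇ_; _%_; _/_; nonTrivial⇒n>1; ≢-nonZero; >-nonZero⁻¹)
import Data.Nat.Coprimality as Coprime
open import Data.Nat.Properties
open import Data.Nat.DivMod using (m≡m%n+[m/n]*n; m%n<n; m%n≤m; %-congˡ; %-congʳ; [m+kn]%n≡m%n; n%n≡0; m<n⇒m%n≡m; n/1≡n; m∣n⇒o%n%m≡o%m; m%[n*o]/o≡m/o%n)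
open import Data.Nat.Divisibility
open import Data.Nat.Induction using (<-wellFounded)
open import Data.Nat.Primality using (Prime; euclidsLemma; prime⇒nonTrivial)
open import Data.Nat.Tactic.RingSolver using (solve-∀)
open import Data.Product using (Σ; ∃; _×_; _,_)
open import Data.Rational as ℚ using (ℚ; mkℚ; 1ℚ)
import Data.Rational.Properties as ℚP
import Data.Rational.Solver as ℚSolver
open import Data.Sum using (inj₁; inj₂)
open import Function using (Equivalence; _⇔_; mk⇔)
open import Function.Construct.Symmetry using (⇔-sym)
open import Function.Properties.Equivalence using (⇔-setoid)
open import Induction.WellFounded using (Acc; acc)
open import Level using (0ℓ)
open import Relation.Nullary using (¬_; yes; no; does; contradiction)
open import Relation.Nullary.Decidable using (dec-true; dec-false; does-⇔)
open import Relation.Binary.PropositionalEquality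
import Relation.Binary.Reasoning.Setoid as SetoidReasoning
open import Algebra.Properties.CommutativeSemigroup +-commutativeSemigroup
  using () renaming (interchange to +-interchange; xy∙z≈xz∙y to +-right-comm)
open import Algebra.Properties.CommutativeSemigroup *-commutativeSemigroup
  using () renaming (interchange to *-interchange; xy∙z≈xz∙y to *-right-comm)

ind : Bool → ℕ
ind b = if b then 1 else 0

≤ᵇ-true⇒≤ : ∀ {m n} → (m ≤ᵇ n) ≡ true → m ≤ n
≤ᵇ-true⇒≤ {m} {n} m≤ᵇn = ≤ᵇ⇒≤ m n (Equivalence.from T-≡ m≤ᵇn)

sumBelow-cong : ∀ J {f g : ℕ → ℕ} → (∀ m → m < J → f m ≡ g m) → sumBelow J f ≡ sumBelow J g
sumBelow-cong zero    f≡g = refl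
sumBelow-cong (suc J) f≡g =
  cong₂ _+_ (sumBelow-cong J (λ m m<J → f≡g m (m<n⇒m<1+n m<J))) (f≡g J ≤-refl)

sumBelow-+ : ∀ J (f g : ℕ → ℕ) → sumBelow J f + sumBelow J g ≡ sumBelow J (λ m → f m + g m)
sumBelow-+ zero    f g = refl
sumBelow-+ (suc J) f g =
  trans (+-interchange (sumBelow J f) (f J) (sumBelow J g) (g J)) (cong (_+ (f J + g J)) (sumBelow-+ J f g))

countBelow≡sumBelow : ∀ J P → countBelow J P ≡ sumBelow J (λ m → ind (P m))
countBelow≡sumBelow zero    P = refl
countBelow≡sumBelow (suc J) P = cong (_+ ind (P J)) (countBelow≡sumBelow J P)

countBelow-cong : ∀ J {P Q : ℕ → Bool} → (∀ m → m < J → P m ≡ Q m) → countBelow J P ≡ countBelow J Q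
countBelow-cong J P≡Q = trans (countBelow≡sumBelow J _)
  (trans (sumBelow-cong J (λ m m<J → cong ind (P≡Q m m<J))) (sym (countBelow≡sumBelow J _)))

count-below : ∀ J e → sumBelow J (λ m → ind (m <ᵇ e)) ≡ J ⊓ e
count-below zero    e = refl
count-below (suc J) e with J <? e
... | yes J<e = begin
  sumBelow J _ + ind (J <ᵇ e) ≡⟨ cong₂ _+_ (count-below J e) (cong ind (dec-true (J <? e) J<e)) ⟩
  J ⊓ e + 1                   ≡⟨ cong (_+ 1) (m≤n⇒m⊓n≡m (<⇒≤ J<e)) ⟩
  J + 1                       ≡⟨ +-comm J 1 ⟩
  suc J                       ≡⟨ m≤n⇒m⊓n≡m J<e ⟨
  suc J ⊓ e                   ∎
  where open ≡-Reasoning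
... | no J≮e = begin
  sumBelow J _ + ind (J <ᵇ e) ≡⟨ cong₂ _+_ (count-below J e) (cong ind (dec-false (J <? e) J≮e)) ⟩
  J ⊓ e + 0                   ≡⟨ +-identityʳ _ ⟩
  J ⊓ e                       ≡⟨ m≥n⇒m⊓n≡n (≮⇒≥ J≮e) ⟩
  e                           ≡⟨ m≥n⇒m⊓n≡n (m≤n⇒m≤1+n (≮⇒≥ J≮e)) ⟨
  suc J ⊓ e                   ∎
  where open ≡-Reasoning

threshold-step : ∀ Q x → ind (Q ≤ᵇ x) + ind (suc x ≡ᵇ Q) ≡ ind (Q ≤ᵇ suc x)
threshold-step Q x with Q ≤? x | suc x ≟ Q
... | yes Q≤x | _ = begin
  ind (Q ≤ᵇ x) + ind (suc x ≡ᵇ Q)  ≡⟨ cong₂ (λ u v → ind u + ind v) (dec-true (Q ≤? x) Q≤x) (dec-false (suc x ≟ Q) (>⇒≢ (s≤s Q≤x))) ⟩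
  1                                ≡⟨ cong ind (dec-true (Q ≤? suc x) (m≤n⇒m≤1+n Q≤x)) ⟨
  ind (Q ≤ᵇ suc x)                 ∎
  where open ≡-Reasoning
... | no Q≰x | yes refl = begin
  ind (suc x ≤ᵇ x) + ind (suc x ≡ᵇ suc x)  ≡⟨ cong₂ (λ u v → ind u + ind v) (dec-false (suc x ≤? x) Q≰x) (dec-true (suc x ≟ suc x) refl) ⟩
  1                                        ≡⟨ cong ind (dec-true (suc x ≤? suc x) ≤-refl) ⟨
  ind (suc x ≤ᵇ suc x)                     ∎
  where open ≡-Reasoning
... | no Q≰x | no 1+x≢Q = begin
  ind (Q ≤ᵇ x) + ind (suc x ≡ᵇ Q)  ≡⟨ cong₂ (λ u v → ind u + ind v) (dec-false (Q ≤? x) Q≰x) (dec-false (suc x ≟ Q) 1+x≢Q) ⟩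
  0                                ≡⟨ cong ind (dec-false (Q ≤? suc x) Q≰1+x) ⟨
  ind (Q ≤ᵇ suc x)                 ∎
  where
  open ≡-Reasoning
  Q≰1+x : ¬ (Q ≤ suc x)
  Q≰1+x Q≤1+x = 1+x≢Q (≤-antisym (≰⇒> Q≰x) Q≤1+x)

∣x+s*d⇔∣x : ∀ {d} x s → (d ∣ x + s * d ⇔ d ∣ x)
∣x+s*d⇔∣x {d} x s = mk⇔ (λ d∣ → ∣m+n∣m⇒∣n (subst (d ∣_) (+-comm x _) d∣) (n∣m*n s))
                    (λ d∣x → ∣m∣n⇒∣m+n d∣x (n∣m*n s))

multiple<2d⇒≡ : ∀ {d x} → 0 < x → x < d + d → d ∣ x → x ≡ d
multiple<2d⇒≡     x>0 _    (divides zero          refl) = contradiction refl (<⇒≢ x>0)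
multiple<2d⇒≡ {d} _   _    (divides (suc zero)    refl) = +-identityʳ d
multiple<2d⇒≡ {d} _   x<2d (divides (suc (suc q)) refl) =
  contradiction (+-monoʳ-≤ d (m≤m+n d (q * d))) (<⇒≱ x<2d)

∣⇔≡ : ∀ {d x} → 0 < x → x < d + d → (d ∣ x ⇔ x ≡ d)
∣⇔≡ x>0 x<2d = mk⇔ (multiple<2d⇒≡ x>0 x<2d) (λ { refl → ∣-refl })

mod-split : ∀ n Q q .{{_ : NonZero Q}} .{{_ : NonZero q}} {{_ : NonZero (q * Q)}} →
  n % (q * Q) ≡ (n / Q % q) * Q + n % Q
mod-split n Q q = begin
  n % (q * Q)                             ≡⟨ m≡m%n+[m/n]*n (n % (q * Q)) Q ⟩
  n % (q * Q) % Q + n % (q * Q) / Q * Q   ≡⟨ cong₂ _+_ (m∣n⇒o%n%m≡o%m Q (q * Q) n (n∣m*n q))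
                                                      (cong (_* Q) (m%[n*o]/o≡m/o%n n q Q)) ⟩
  n % Q + (n / Q % q) * Q                 ≡⟨ +-comm (n % Q) _ ⟩
  (n / Q % q) * Q + n % Q                 ∎
  where open ≡-Reasoning

-- One-digit carry rule: a digit sum s (in units of Q) plus an incoming amount Y < 2Q
-- reaches P·Q iff s ≥ P, or s = P-1 and Y ≥ Q.
carry-rule : ∀ P s Q Y → 1 ≤ P → Y < Q + Q →
  (P * Q ≤ᵇ s * Q + Y) ≡ (P ≤ᵇ s) ∨ ((s ≡ᵇ P ∸ 1) ∧ (Q ≤ᵇ Y))
carry-rule (suc P) s Q Y _ Y<2Q with suc P ≤? s | s ≟ P
... | yes P<s | _ = begin
  (suc P * Q ≤ᵇ s * Q + Y)  ≡⟨ dec-true (_ ≤? _) (≤-trans (*-monoˡ-≤ Q P<s) (m≤m+n (s * Q) Y)) ⟩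
  true                      ≡⟨ cong (_∨ ((s ≡ᵇ P) ∧ (Q ≤ᵇ Y))) (dec-true (suc P ≤? s) P<s) ⟨
  (suc P ≤ᵇ s) ∨ ((s ≡ᵇ P) ∧ (Q ≤ᵇ Y)) ∎
  where open ≡-Reasoning
... | no P≮s | no s≢P =
  trans (dec-false (_ ≤? _) (<⇒≱ overflow-impossible))
        (sym (cong₂ (λ x y → x ∨ (y ∧ (Q ≤ᵇ Y))) (dec-false (suc P ≤? s) P≮s) (dec-false (s ≟ P) s≢P)))
  where
  overflow-impossible : s * Q + Y < suc P * Q
  overflow-impossible = begin-strict
    s * Q + Y        <⟨ +-monoʳ-< (s * Q) Y<2Q ⟩
    s * Q + (Q + Q)  ≡⟨ two-more s Q ⟩
    suc (suc s) * Q  ≤⟨ *-monoˡ-≤ Q (s≤s (≤∧≢⇒< (≤-pred (≰⇒> P≮s)) s≢P)) ⟩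
    suc P * Q        ∎
    where
    open ≤-Reasoning
    two-more : ∀ s Q → s * Q + (Q + Q) ≡ suc (suc s) * Q
    two-more = solve-∀
... | no P≮s | yes refl = begin
  (suc s * Q ≤ᵇ s * Q + Y)  ≡⟨ does-⇔ (mk⇔ to from) (_ ≤? _) (Q ≤? Y) ⟩
  (Q ≤ᵇ Y)                  ≡⟨ cong₂ (λ x y → x ∨ (y ∧ (Q ≤ᵇ Y))) (dec-false (suc s ≤? s) P≮s) (dec-true (s ≟ s) refl) ⟨
  (suc s ≤ᵇ s) ∨ ((s ≡ᵇ s) ∧ (Q ≤ᵇ Y)) ∎
  where
  open ≡-Reasoning
  to : Q + s * Q ≤ s * Q + Y → Q ≤ Y
  to h = +-cancelˡ-≤ (s * Q) Q Y (subst (_≤ s * Q + Y) (+-comm Q (s * Q)) h)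
  from : Q ≤ Y → Q + s * Q ≤ s * Q + Y
  from h = subst (_≤ s * Q + Y) (+-comm (s * Q) Q) (+-monoʳ-≤ (s * Q) h)

anyUpTo-suc : ∀ m P → anyUpTo (suc m) P ≡ P 0 ∨ anyUpTo m (λ j → P (suc j))
anyUpTo-suc zero    P = refl
anyUpTo-suc (suc m) P = trans (cong (_∨ P (suc (suc m))) (anyUpTo-suc m P)) (∨-assoc (P 0) _ _)

allBelow-suc : ∀ j P → allBelow (suc j) P ≡ P 0 ∧ allBelow j (λ i → P (suc i))
allBelow-suc zero    P = sym (∧-identityʳ (P 0))
allBelow-suc (suc j) P = trans (cong (_∧ P (suc j)) (allBelow-suc j P)) (∧-assoc (P 0) _ _)

anyUpTo-cong : ∀ m {P Q : ℕ → Bool} → (∀ j → P j ≡ Q j) → anyUpTo m P ≡ anyUpTo m Q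
anyUpTo-cong zero    P≡Q = P≡Q 0
anyUpTo-cong (suc m) P≡Q = cong₂ _∨_ (anyUpTo-cong m P≡Q) (P≡Q (suc m))

anyUpTo-∧ : ∀ m x P → anyUpTo m (λ j → x ∧ P j) ≡ x ∧ anyUpTo m P
anyUpTo-∧ zero    x P = refl
anyUpTo-∧ (suc m) x P =
  trans (cong (_∨ (x ∧ P (suc m))) (anyUpTo-∧ m x P)) (sym (∧-distribˡ-∨ x _ _))

condM-suc : ∀ p a b m → condM p a b (suc m) ≡
  (p ≤ᵇ a (suc m) + b (suc m)) ∨ ((a (suc m) + b (suc m) ≡ᵇ p ∸ 1) ∧ condM p a b m)
condM-suc p a b m = begin
  anyUpTo (suc m) F                                          ≡⟨ anyUpTo-suc m F ⟩
  G (suc m) ∨ anyUpTo m (λ j → F (suc j))                    ≡⟨ cong (G (suc m) ∨_) (anyUpTo-cong m peel) ⟩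
  G (suc m) ∨ anyUpTo m (λ j → E (suc m) ∧ F′ j)             ≡⟨ cong (G (suc m) ∨_) (anyUpTo-∧ m (E (suc m)) F′) ⟩
  G (suc m) ∨ (E (suc m) ∧ condM p a b m)                    ∎
  where
  open ≡-Reasoning
  G E : ℕ → Bool
  G i = p ≤ᵇ a i + b i
  E i = a i + b i ≡ᵇ p ∸ 1
  F F′ : ℕ → Bool
  F  j = allBelow j (λ i → E (suc m ∸ i)) ∧ G (suc m ∸ j)
  F′ j = allBelow j (λ i → E (m ∸ i)) ∧ G (m ∸ j)
  peel : ∀ j → F (suc j) ≡ E (suc m) ∧ F′ j
  peel j = trans (cong (_∧ G (m ∸ j)) (allBelow-suc j (λ i → E (suc m ∸ i)))) (∧-assoc (E (suc m)) _ _)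

ℕ→ℚ≡mkℚ : ∀ n → ℕ→ℚ n ≡ mkℚ (ℤ.+ n) 0 (Coprime.sym (Coprime.1-coprimeTo n))
ℕ→ℚ≡mkℚ n = ℚP.normalize-coprime (Coprime.sym (Coprime.1-coprimeTo n))

ℕ→ℚ-+ : ∀ m n → ℕ→ℚ (m + n) ≡ ℕ→ℚ m ℚ.+ ℕ→ℚ n
ℕ→ℚ-+ m n = sym (trans (cong₂ ℚ._+_ (ℕ→ℚ≡mkℚ m) (ℕ→ℚ≡mkℚ n))
  (cong (ℚ._/ 1) (trans (cong₂ ℤ._+_ (ℤP.*-identityʳ (ℤ.+ m)) (ℤP.*-identityʳ (ℤ.+ n))) (sym (ℤP.pos-+ m n)))))

ℕ→ℚ-* : ∀ m n → ℕ→ℚ (m * n) ≡ ℕ→ℚ m ℚ.* ℕ→ℚ n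
ℕ→ℚ-* m n = sym (trans (cong₂ ℚ._*_ (ℕ→ℚ≡mkℚ m) (ℕ→ℚ≡mkℚ n)) (cong (ℚ._/ 1) (sym (ℤP.pos-* m n))))

1/n*n≡1 : ∀ n .{{_ : NonZero n}} → ((ℤ.+ 1) ℚ./ n) ℚ.* ℕ→ℚ n ≡ 1ℚ
1/n*n≡1 (suc n) = trans (cong₂ ℚ._*_ 1/n≡mkℚ (ℕ→ℚ≡mkℚ (suc n)))
  (ℚP.*-inverseˡ (mkℚ (ℤ.+ suc n) 0 (Coprime.sym (Coprime.1-coprimeTo (suc n)))))
  where
  1/n≡mkℚ : (ℤ.+ 1) ℚ./ suc n ≡ mkℚ (ℤ.+ 1) n (Coprime.1-coprimeTo (suc n))
  1/n≡mkℚ = ℚP.normalize-coprime (Coprime.1-coprimeTo (suc n))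

ℕ→ℚ-cancelʳ : ∀ a b x .{{_ : NonZero x}} → a ℚ.* ℕ→ℚ x ≡ b ℚ.* ℕ→ℚ x → a ≡ b
ℕ→ℚ-cancelʳ a b x ax≡bx = trans (undo a) (trans (cong (ℚ._* w) ax≡bx) (sym (undo b)))
  where
  w = (ℤ.+ 1) ℚ./ x
  X = ℕ→ℚ x
  undo : ∀ y → y ≡ (y ℚ.* X) ℚ.* w
  undo y = begin
    y                  ≡⟨ ℚP.*-identityʳ y ⟨
    y ℚ.* 1ℚ           ≡⟨ cong (y ℚ.*_) (1/n*n≡1 x) ⟨
    y ℚ.* (w ℚ.* X)    ≡⟨ cong (y ℚ.*_) (ℚP.*-comm w X) ⟩
    y ℚ.* (X ℚ.* w)    ≡⟨ ℚP.*-assoc y X w ⟨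
    (y ℚ.* X) ℚ.* w    ∎
    where open ≡-Reasoning

-- K(n) = ∏_{i<n} k(1+ik), the integer that c(n,k) equals up to the factor n!.
numerator : ℕ → ℕ → ℕ
numerator k zero    = 1
numerator k (suc n) = numerator k n * (k * (1 + n * k))

factor-identity : ∀ k .{{_ : NonZero k}} n →
  (ℚ.- ((ℤ.+ 1) ℚ./ k) ℚ.- ℕ→ℚ n) ℚ.* (ℚ.- ℕ→ℚ (k * k)) ≡ ℕ→ℚ (k * (1 + n * k))
factor-identity k n = begin
  (ℚ.- w ℚ.- N) ℚ.* (ℚ.- ℕ→ℚ (k * k))     ≡⟨ cong (λ z → (ℚ.- w ℚ.- N) ℚ.* (ℚ.- z)) (ℕ→ℚ-* k k) ⟩
  (ℚ.- w ℚ.- N) ℚ.* (ℚ.- (K ℚ.* K))       ≡⟨ solve 3 (λ w N K → (:- w :- N) :* (:- (K :* K)) := (w :* K) :* K :+ N :* K :* K) refl w N K ⟩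
  (w ℚ.* K) ℚ.* K ℚ.+ N ℚ.* K ℚ.* K       ≡⟨ cong (λ z → z ℚ.* K ℚ.+ N ℚ.* K ℚ.* K) (1/n*n≡1 k) ⟩
  1ℚ ℚ.* K ℚ.+ N ℚ.* K ℚ.* K              ≡⟨ solve 2 (λ N K → con 1ℚ :* K :+ N :* K :* K := K :* (con 1ℚ :+ N :* K)) refl N K ⟩
  K ℚ.* (1ℚ ℚ.+ N ℚ.* K)                  ≡⟨ cong (λ z → K ℚ.* (1ℚ ℚ.+ z)) (ℕ→ℚ-* n k) ⟨
  K ℚ.* (1ℚ ℚ.+ ℕ→ℚ (n * k))              ≡⟨ cong (K ℚ.*_) (ℕ→ℚ-+ 1 (n * k)) ⟨
  K ℚ.* ℕ→ℚ (1 + n * k)                   ≡⟨ ℕ→ℚ-* k (1 + n * k) ⟨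
  ℕ→ℚ (k * (1 + n * k))                   ∎
  where
  open ≡-Reasoning
  open ℚSolver.+-*-Solver
  w = (ℤ.+ 1) ℚ./ k
  N = ℕ→ℚ n
  K = ℕ→ℚ k

c-suc : ∀ k .{{_ : NonZero k}} n → c (suc n) k ℚ.* ℕ→ℚ (suc n) ≡ c n k ℚ.* ℕ→ℚ (k * (1 + n * k))
c-suc k n = begin
  ((g ℚ.* A ℚ.* v) ℚ.* (m ℚ.* M)) ℚ.* X  ≡⟨ solve 6 (λ g A v m M X → ((g :* A :* v) :* (m :* M)) :* X := (g :* M) :* (A :* m) :* (v :* X)) refl g A v m M X ⟩
  (g ℚ.* M) ℚ.* (A ℚ.* m) ℚ.* (v ℚ.* X)  ≡⟨ cong₂ (λ x y → c n k ℚ.* x ℚ.* y) (factor-identity k n) (1/n*n≡1 (suc n)) ⟩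
  c n k ℚ.* F ℚ.* 1ℚ                     ≡⟨ ℚP.*-identityʳ _ ⟩
  c n k ℚ.* F                            ∎
  where
  open ≡-Reasoning
  open ℚSolver.+-*-Solver
  g = gbinom (ℚ.- ((ℤ.+ 1) ℚ./ k)) n
  A = ℚ.- ((ℤ.+ 1) ℚ./ k) ℚ.- ℕ→ℚ n
  v = (ℤ.+ 1) ℚ./ suc n
  m = ℚ.- ℕ→ℚ (k * k)
  M = m ^ℚ n
  X = ℕ→ℚ (suc n)
  F = ℕ→ℚ (k * (1 + n * k))

c·n!≡numerator : ∀ k .{{_ : NonZero k}} n → c n k ℚ.* ℕ→ℚ (n !) ≡ ℕ→ℚ (numerator k n)
c·n!≡numerator k zero    = refl
c·n!≡numerator k (suc n) = begin
  c (suc n) k ℚ.* ℕ→ℚ (suc n * n !)          ≡⟨ cong (c (suc n) k ℚ.*_) (ℕ→ℚ-* (suc n) (n !)) ⟩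
  c (suc n) k ℚ.* (ℕ→ℚ (suc n) ℚ.* f)       ≡⟨ ℚP.*-assoc (c (suc n) k) _ f ⟨
  c (suc n) k ℚ.* ℕ→ℚ (suc n) ℚ.* f         ≡⟨ cong (ℚ._* f) (c-suc k n) ⟩
  c n k ℚ.* F ℚ.* f                         ≡⟨ solve 3 (λ C F f → C :* F :* f := (C :* f) :* F) refl (c n k) F f ⟩
  (c n k ℚ.* f) ℚ.* F                       ≡⟨ cong (ℚ._* F) (c·n!≡numerator k n) ⟩
  ℕ→ℚ (numerator k n) ℚ.* F                 ≡⟨ ℕ→ℚ-* (numerator k n) _ ⟨
  ℕ→ℚ (numerator k (suc n))                 ∎
  where
  open ≡-Reasoning
  open ℚSolver.+-*-Solver
  f = ℕ→ℚ (n !)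
  F = ℕ→ℚ (k * (1 + n * k))

module Valuation {p : ℕ} .{{_ : NonZero p}} (p-prime : Prime p) where

  record IsValuation (e x : ℕ) : Set where
    constructor valuation
    field
      unit   : ℕ
      p∤unit : ¬ (p ∣ unit)
      x≡p^e*unit : x ≡ p ^ e * unit

  1<p : 1 < p
  1<p = nonTrivial⇒n>1 p {{prime⇒nonTrivial p-prime}}

  p∤1 : ¬ (p ∣ 1)
  p∤1 p∣1 = <⇒≢ 1<p (sym (∣1⇒≡1 p∣1))

  e<p^e : ∀ e → e < p ^ e
  e<p^e zero    = s≤s z≤n
  e<p^e (suc e) = begin-strict
    suc e          <⟨ s≤s (e<p^e e) ⟩
    suc (p ^ e)    ≤⟨ +-monoˡ-≤ (p ^ e) (m^n>0 p e) ⟩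
    p ^ e + p ^ e  ≡⟨ cong (p ^ e +_) (+-identityʳ (p ^ e)) ⟨
    2 * p ^ e      ≤⟨ *-monoˡ-≤ (p ^ e) 1<p ⟩
    p * p ^ e      ∎
    where open ≤-Reasoning

  p^j∣k*y⇒p^j∣y : ∀ {k} j y → ¬ (p ∣ k) → p ^ j ∣ k * y → p ^ j ∣ y
  p^j∣k*y⇒p^j∣y zero    y p∤k _ = 1∣ y
  p^j∣k*y⇒p^j∣y {k} (suc j) y p∤k p^j+1∣ky with euclidsLemma k y p-prime (m*n∣⇒m∣ p (p ^ j) p^j+1∣ky)
  ... | inj₁ p∣k = ⊥-elim (p∤k p∣k)
  ... | inj₂ (divides y′ refl) = subst (_∣ y′ * p) (*-comm (p ^ j) p) (*-monoˡ-∣ p p^j∣y′)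
    where
    p^j∣y′ : p ^ j ∣ y′
    p^j∣y′ = p^j∣k*y⇒p^j∣y j y′ p∤k
      (*-cancelʳ-∣ p (subst₂ _∣_ (*-comm p (p ^ j)) (sym (*-assoc k y′ p)) p^j+1∣ky))

  p^j∣p^e*w⇔j≤e : ∀ j e {w} → ¬ (p ∣ w) → (p ^ j ∣ p ^ e * w ⇔ j ≤ e)
  p^j∣p^e*w⇔j≤e j e {w} p∤w = mk⇔ (to j e) (from j e)
    where
    to : ∀ j e → p ^ j ∣ p ^ e * w → j ≤ e
    to zero    e       _ = z≤n
    to (suc j) zero    d = ⊥-elim (p∤w (subst (p ∣_) (*-identityˡ w) (m*n∣⇒m∣ p (p ^ j) d)))
    to (suc j) (suc e) d = s≤s (to j e (*-cancelˡ-∣ p (subst (p * p ^ j ∣_) (*-assoc p (p ^ e) w) d)))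
    from : ∀ j e → j ≤ e → p ^ j ∣ p ^ e * w
    from zero    e       _         = 1∣ _
    from (suc j) (suc e) (s≤s j≤e) = subst (p * p ^ j ∣_) (sym (*-assoc p (p ^ e) w)) (*-monoʳ-∣ p (from j e j≤e))

  ν-trunc : ℕ → ℕ → ℕ
  ν-trunc J x = sumBelow J (λ m → ind (does (p ^ suc m ∣? x)))

  count-prime-powers : ∀ {e x} J → IsValuation e x → e ≤ J → ν-trunc J x ≡ e
  count-prime-powers {e} J (valuation w p∤w refl) e≤J = begin
    sumBelow J (λ m → ind (does (p ^ suc m ∣? p ^ e * w)))
      ≡⟨ sumBelow-cong J (λ m _ → cong ind (does-⇔ (p^j∣p^e*w⇔j≤e (suc m) e p∤w) (_ ∣? _) (m <? e))) ⟩
    sumBelow J (λ m → ind (m <ᵇ e))  ≡⟨ count-below J e ⟩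
    J ⊓ e                            ≡⟨ m≥n⇒m⊓n≡n e≤J ⟩
    e                                ∎
    where open ≡-Reasoning

  valuation-exists : ∀ x → 0 < x → ∃ λ e → IsValuation e x
  valuation-exists x x>0 = go x x>0 (<-wellFounded x)
    where
    go : ∀ x → 0 < x → Acc _<_ x → ∃ λ e → IsValuation e x
    go x x>0 (acc smaller) with p ∣? x
    ... | no p∤x = 0 , valuation x p∤x (sym (*-identityˡ x))
    ... | yes (divides y refl) with go y y>0 (smaller (m<m*n y p {{≢-nonZero (≢-sym (<⇒≢ y>0))}} 1<p))
      where
      y>0 : 0 < y
      y>0 = n≢0⇒n>0 (λ { refl → <⇒≢ x>0 refl })
    ...   | e , valuation w p∤w refl = suc e , valuation w p∤w (trans (*-comm (p ^ e * w) p) (sym (*-assoc p (p ^ e) w)))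

  valuation-unit : ∀ {w} → ¬ (p ∣ w) → IsValuation 0 w
  valuation-unit {w} p∤w = valuation w p∤w (sym (*-identityˡ w))

  valuation-* : ∀ {e f x y} → IsValuation e x → IsValuation f y → IsValuation (e + f) (x * y)
  valuation-* {e} {f} (valuation w p∤w refl) (valuation v p∤v refl) = valuation (w * v) p∤wv (begin
    p ^ e * w * (p ^ f * v)  ≡⟨ *-interchange (p ^ e) w (p ^ f) v ⟩
    p ^ e * p ^ f * (w * v)  ≡⟨ cong (_* (w * v)) (^-distribˡ-+-* p e f) ⟨
    p ^ (e + f) * (w * v)    ∎)
    where
    open ≡-Reasoning
    p∤wv : ¬ (p ∣ w * v)
    p∤wv p∣wv with euclidsLemma w v p-prime p∣wv
    ... | inj₁ p∣w = p∤w p∣w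
    ... | inj₂ p∣v = p∤v p∣v

  valuation-< : ∀ {e x} → IsValuation e x → e < x
  valuation-< {e} (valuation w p∤w refl) = <-≤-trans (e<p^e e) (m≤m*n (p ^ e) w {{w≢0}})
    where
    w≢0 : NonZero w
    w≢0 = ≢-nonZero (λ { refl → p∤w (p ∣0) })

  ValP-from-product : ∀ {N e A B} (x : ℚ) → x ℚ.* ℕ→ℚ B ≡ ℕ→ℚ A →
    IsValuation (N + e) A → IsValuation e B → ValP p N x
  ValP-from-product x _ _ (valuation zero p∤0 refl) = contradiction (p ∣0) p∤0
  ValP-from-product {N} {e} x xB≡A (valuation u p∤u refl) (valuation (suc v) p∤v refl) =
    ℤ.+ u , v , p∤u , p∤v , trans (ℕ→ℚ-cancelʳ _ _ (p ^ e) {{m^n≢0 p e}} cancelled) (cong (ℚ._/ 1) (ℤP.pos-* (p ^ N) u))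
    where
    V = ℕ→ℚ (suc v)
    P = ℕ→ℚ (p ^ e)
    cancelled : x ℚ.* V ℚ.* P ≡ ℕ→ℚ (p ^ N * u) ℚ.* P
    cancelled = begin
      x ℚ.* V ℚ.* P                 ≡⟨ ℚP.*-assoc x V P ⟩
      x ℚ.* (V ℚ.* P)               ≡⟨ cong (x ℚ.*_) (trans (ℚP.*-comm V P) (sym (ℕ→ℚ-* (p ^ e) (suc v)))) ⟩
      x ℚ.* ℕ→ℚ (p ^ e * suc v)     ≡⟨ xB≡A ⟩
      ℕ→ℚ (p ^ (N + e) * u)         ≡⟨ cong (λ z → ℕ→ℚ (z * u)) (^-distribˡ-+-* p N e) ⟩
      ℕ→ℚ (p ^ N * p ^ e * u)       ≡⟨ cong ℕ→ℚ (*-right-comm (p ^ N) (p ^ e) u) ⟩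
      ℕ→ℚ (p ^ N * u * p ^ e)       ≡⟨ ℕ→ℚ-* (p ^ N * u) (p ^ e) ⟩
      ℕ→ℚ (p ^ N * u) ℚ.* P         ∎
      where open ≡-Reasoning

module Carries (k p : ℕ) .{{_ : NonZero k}} .{{_ : NonZero p}} (p-prime : Prime p) (p∤k : ¬ (p ∣ k))
               (b : ℕ → ℕ) (b<p : ∀ m → b m < p)
               (hyp : ∀ M → p ^ M ∣ (k * (1 + sumBelow M (λ m → b m * p ^ m)) ∸ 1)) where

  open Valuation p-prime

  -- β_M = Σ_{m<M} b_m p^m, the truncation of the p-adic expansion of 1/k - 1.
  β : ℕ → ℕ
  β M = sumBelow M (λ m → b m * p ^ m)

  β<p^M : ∀ M → β M < p ^ M
  β<p^M zero    = s≤s z≤n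
  β<p^M (suc M) = ≤-trans (+-monoˡ-≤ (b M * p ^ M) (β<p^M M)) (*-monoˡ-≤ (p ^ M) (b<p M))

  k-inverse : ∀ M → ∃ λ t → k * (1 + β M) ≡ 1 + t * p ^ M
  k-inverse M with hyp M
  ... | divides t k[1+β]∸1≡t*p^M = t , trans (sym (m+[n∸m]≡n 1≤k[1+β])) (cong (1 +_) k[1+β]∸1≡t*p^M)
    where
    1≤k[1+β] : 1 ≤ k * (1 + β M)
    1≤k[1+β] = *-mono-≤ (>-nonZero⁻¹ k) (s≤s z≤n)

  -- Position m is a carry of n when adding n and β overflows the lowest m+1 digits.
  carry : ℕ → ℕ → Bool
  carry n m = p ^ suc m ≤ᵇ (n % p ^ suc m) {{m^n≢0 p (suc m)}} + β (suc m)

  carry-suc : ∀ n m → let s = digit p n (suc m) + b (suc m) in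
    carry n (suc m) ≡ (p ≤ᵇ s) ∨ ((s ≡ᵇ p ∸ 1) ∧ carry n m)
  carry-suc n m = trans (cong (p * Q ≤ᵇ_) regroup)
    (carry-rule p s Q (n % Q + β (suc m)) (>-nonZero⁻¹ p) (+-mono-< (m%n<n n Q) (β<p^M (suc m))))
    where
    instance
      Q≢0 : NonZero (p ^ suc m)
      Q≢0 = m^n≢0 p (suc m)
      pQ≢0 : NonZero (p ^ suc (suc m))
      pQ≢0 = m^n≢0 p (suc (suc m))
    Q = p ^ suc m
    a = digit p n (suc m)
    s = a + b (suc m)
    regroup : n % (p * Q) + (β (suc m) + b (suc m) * Q) ≡ s * Q + (n % Q + β (suc m))
    regroup = begin
      n % (p * Q) + (β (suc m) + b (suc m) * Q)     ≡⟨ cong (_+ (β (suc m) + b (suc m) * Q)) (mod-split n Q p) ⟩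
      a * Q + n % Q + (β (suc m) + b (suc m) * Q)  ≡⟨ collect a (b (suc m)) Q (n % Q) (β (suc m)) ⟩
      s * Q + (n % Q + β (suc m))                  ∎
      where
      open ≡-Reasoning
      collect : ∀ a c Q r β → a * Q + r + (β + c * Q) ≡ (a + c) * Q + (r + β)
      collect = solve-∀

  condM≡carry : ∀ n m → condM p (digit p n) b m ≡ carry n m
  condM≡carry n zero    = cong₂ _≤ᵇ_ (sym (*-identityʳ p)) (cong₂ _+_ digit₀ (sym (*-identityʳ (b 0))))
    where
    instance
      p≢0 : NonZero (p * 1)
      p≢0 = m^n≢0 p 1
    digit₀ : digit p n 0 ≡ n % (p * 1)
    digit₀ = trans (%-congˡ (n/1≡n n)) (%-congʳ (sym (*-identityʳ p)))
  condM≡carry n (suc m) = begin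
    condM p (digit p n) b (suc m)   ≡⟨ condM-suc p (digit p n) b m ⟩
    (p ≤ᵇ s) ∨ ((s ≡ᵇ p ∸ 1) ∧ condM p (digit p n) b m)  ≡⟨ cong (λ z → (p ≤ᵇ s) ∨ ((s ≡ᵇ p ∸ 1) ∧ z)) (condM≡carry n m) ⟩
    (p ≤ᵇ s) ∨ ((s ≡ᵇ p ∸ 1) ∧ carry n m)                ≡⟨ carry-suc n m ⟨
    carry n (suc m)                 ∎
    where
    open ≡-Reasoning
    s = digit p n (suc m) + b (suc m)

  module AtLevel (n m : ℕ) where
    instance
      Q≢0 : NonZero (p ^ suc m)
      Q≢0 = m^n≢0 p (suc m)

    Q r s β′ : ℕ
    Q  = p ^ suc m
    r  = n % Q
    s  = n / Q
    β′ = β (suc m)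

    n≡r+sQ : n ≡ r + s * Q
    n≡r+sQ = m≡m%n+[m/n]*n n Q

    reduce-1+nk : ∀ t → k * (1 + β′) ≡ 1 + t * Q → (1 + n * k) + t * Q ≡ k * suc (r + β′) + (k * s) * Q
    reduce-1+nk t k[1+β]≡1+tQ = begin
      (1 + n * k) + t * Q                 ≡⟨ cong (λ z → (1 + z * k) + t * Q) n≡r+sQ ⟩
      (1 + (r + s * Q) * k) + t * Q       ≡⟨ expand r s Q k t ⟩
      (1 + t * Q) + k * r + (k * s) * Q   ≡⟨ cong (λ z → z + k * r + (k * s) * Q) k[1+β]≡1+tQ ⟨
      k * (1 + β′) + k * r + (k * s) * Q  ≡⟨ regroup k β′ r s Q ⟩
      k * suc (r + β′) + (k * s) * Q      ∎
      where
      open ≡-Reasoning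
      expand : ∀ r s Q k t → (1 + (r + s * Q) * k) + t * Q ≡ (1 + t * Q) + k * r + (k * s) * Q
      expand = solve-∀
      regroup : ∀ k β r s Q → k * (1 + β) + k * r + (k * s) * Q ≡ k * suc (r + β) + (k * s) * Q
      regroup = solve-∀

    Q∣1+nk⇔ : Q ∣ 1 + n * k ⇔ suc (r + β′) ≡ Q
    Q∣1+nk⇔ with k-inverse (suc m)
    ... | t , k[1+β]≡1+tQ = begin
      Q ∣ 1 + n * k                       ≈⟨ ⇔-sym (∣x+s*d⇔∣x (1 + n * k) t) ⟩
      Q ∣ (1 + n * k) + t * Q             ≡⟨ cong (Q ∣_) (reduce-1+nk t k[1+β]≡1+tQ) ⟩
      Q ∣ k * suc (r + β′) + (k * s) * Q  ≈⟨ ∣x+s*d⇔∣x (k * suc (r + β′)) (k * s) ⟩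
      Q ∣ k * suc (r + β′)                ≈⟨ mk⇔ (p^j∣k*y⇒p^j∣y (suc m) _ p∤k) (∣n⇒∣m*n k) ⟩
      Q ∣ suc (r + β′)                    ≈⟨ ∣⇔≡ (s≤s z≤n) (+-mono-≤-< (m%n<n n Q) (β<p^M (suc m))) ⟩
      suc (r + β′) ≡ Q                    ∎
      where open SetoidReasoning (⇔-setoid 0ℓ)

    Q∣1+n⇔ : Q ∣ suc n ⇔ suc r ≡ Q
    Q∣1+n⇔ = begin
      Q ∣ suc n          ≡⟨ cong (λ z → Q ∣ suc z) n≡r+sQ ⟩
      Q ∣ suc r + s * Q  ≈⟨ ∣x+s*d⇔∣x (suc r) s ⟩
      Q ∣ suc r          ≈⟨ ∣⇔≡ (s≤s z≤n) (≤-<-trans (m%n<n n Q) (m<m+n Q (>-nonZero⁻¹ Q))) ⟩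
      suc r ≡ Q          ∎
      where open SetoidReasoning (⇔-setoid 0ℓ)

    suc-mod : suc n % Q ≡ suc r % Q
    suc-mod = trans (%-congˡ {o = Q} (cong suc n≡r+sQ)) ([m+kn]%n≡m%n (suc r) s Q)

    -- After incrementing n, the carry at this level is [Q ≤ r+β+1], except that a wrap-around
    -- r + 1 = Q resets the residue to 0 and moves that unit into divisibility of n+1.
    carry-after-increment : ind (Q ≤ᵇ suc (r + β′)) ≡ ind (carry (suc n) m) + ind (suc r ≡ᵇ Q)
    carry-after-increment with suc r ≟ Q
    ... | yes 1+r≡Q = begin
      ind (Q ≤ᵇ suc (r + β′))                   ≡⟨ cong ind (dec-true (Q ≤? _) Q≤1+r+β) ⟩
      1                                         ≡⟨ cong₂ (λ u v → ind u + ind v) (dec-false (Q ≤? _) no-carry) (dec-true (suc r ≟ Q) 1+r≡Q) ⟨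
      ind (carry (suc n) m) + ind (suc r ≡ᵇ Q)  ∎
      where
      open ≡-Reasoning
      Q≤1+r+β : Q ≤ suc (r + β′)
      Q≤1+r+β = subst (_≤ suc (r + β′)) 1+r≡Q (s≤s (m≤m+n r β′))
      1+n%Q≡0 : suc n % Q ≡ 0
      1+n%Q≡0 = trans suc-mod (trans (%-congˡ {o = Q} 1+r≡Q) (n%n≡0 Q))
      no-carry : ¬ (Q ≤ suc n % Q + β′)
      no-carry = <⇒≱ (subst (λ z → z + β′ < Q) (sym 1+n%Q≡0) (β<p^M (suc m)))
    ... | no 1+r≢Q = begin
      ind (Q ≤ᵇ suc (r + β′))                   ≡⟨ cong (λ z → ind (Q ≤ᵇ z + β′)) 1+n%Q≡1+r ⟨
      ind (carry (suc n) m)                     ≡⟨ +-identityʳ _ ⟨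
      ind (carry (suc n) m) + 0                 ≡⟨ cong (λ v → ind (carry (suc n) m) + ind v) (dec-false (suc r ≟ Q) 1+r≢Q) ⟨
      ind (carry (suc n) m) + ind (suc r ≡ᵇ Q)  ∎
      where
      open ≡-Reasoning
      1+n%Q≡1+r : suc n % Q ≡ suc r
      1+n%Q≡1+r = trans suc-mod (m<n⇒m%n≡m (≤∧≢⇒< (m%n<n n Q) 1+r≢Q))

    carry-step : ind (carry n m) + ind (does (Q ∣? 1 + n * k)) ≡ ind (carry (suc n) m) + ind (does (Q ∣? suc n))
    carry-step = begin
      ind (carry n m) + ind (does (Q ∣? 1 + n * k))    ≡⟨ cong (λ z → ind (carry n m) + ind z) (does-⇔ Q∣1+nk⇔ (Q ∣? _) (suc (r + β′) ≟ Q)) ⟩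
      ind (Q ≤ᵇ r + β′) + ind (suc (r + β′) ≡ᵇ Q)      ≡⟨ threshold-step Q (r + β′) ⟩
      ind (Q ≤ᵇ suc (r + β′))                          ≡⟨ carry-after-increment ⟩
      ind (carry (suc n) m) + ind (suc r ≡ᵇ Q)         ≡⟨ cong (λ z → ind (carry (suc n) m) + ind z) (does-⇔ Q∣1+n⇔ (Q ∣? _) (suc r ≟ Q)) ⟨
      ind (carry (suc n) m) + ind (does (Q ∣? suc n))  ∎
      where open ≡-Reasoning

  carries : ℕ → ℕ → ℕ
  carries J n = countBelow J (carry n)

  carries-telescope : ∀ J n → carries J n + ν-trunc J (1 + n * k) ≡ carries J (suc n) + ν-trunc J (suc n)
  carries-telescope J n = begin
    carries J n + ν-trunc J (1 + n * k)
      ≡⟨ cong (_+ ν-trunc J (1 + n * k)) (countBelow≡sumBelow J (carry n)) ⟩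
    sumBelow J (λ m → ind (carry n m)) + ν-trunc J (1 + n * k)
      ≡⟨ sumBelow-+ J _ _ ⟩
    sumBelow J (λ m → ind (carry n m) + ind (does (p ^ suc m ∣? 1 + n * k)))
      ≡⟨ sumBelow-cong J (λ m _ → AtLevel.carry-step n m) ⟩
    sumBelow J (λ m → ind (carry (suc n) m) + ind (does (p ^ suc m ∣? suc n)))
      ≡⟨ sumBelow-+ J _ _ ⟨
    sumBelow J (λ m → ind (carry (suc n) m)) + ν-trunc J (suc n)
      ≡⟨ cong (_+ ν-trunc J (suc n)) (countBelow≡sumBelow J (carry (suc n))) ⟨
    carries J (suc n) + ν-trunc J (suc n)
      ∎
    where open ≡-Reasoning

  -- n = 0 has no carries: its residues vanish and β_{m+1} < p^{m+1}.
  carries-zero : ∀ J → carries J 0 ≡ 0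
  carries-zero zero    = refl
  carries-zero (suc J) = cong₂ _+_ (carries-zero J) (cong ind (dec-false (_ ≤? _) (<⇒≱ residue+β<Q)))
    where
    residue+β<Q : (0 % p ^ suc J) {{m^n≢0 p (suc J)}} + β (suc J) < p ^ suc J
    residue+β<Q = ≤-<-trans (+-monoˡ-≤ (β (suc J)) (m%n≤m 0 (p ^ suc J) {{m^n≢0 p (suc J)}})) (β<p^M (suc J))

  -- Carries only occur below position kn: a carry at m forces p^{m+1} ≤ k·(n mod p^{m+1}).
  carry⇒m<kn : ∀ n m → carry n m ≡ true → m < k * n
  carry⇒m<kn n m carry≡true with k-inverse (suc m)
  ... | t , k[1+β]≡1+tQ = <-≤-trans m<Q (≤-trans Q≤kr (*-monoʳ-≤ k (m%n≤m n Q)))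
    where
    open AtLevel n m using (Q; r; β′; Q≢0)
    m<Q : m < Q
    m<Q = <-trans (n<1+n m) (e<p^e (suc m))
    Q≤r+β : Q ≤ r + β′
    Q≤r+β = ≤ᵇ-true⇒≤ carry≡true
    t<k : t < k
    t<k = *-cancelʳ-< Q t k (begin-strict
      t * Q         <⟨ n<1+n (t * Q) ⟩
      1 + t * Q     ≡⟨ k[1+β]≡1+tQ ⟨
      k * (1 + β′)  ≤⟨ *-monoʳ-≤ k (β<p^M (suc m)) ⟩
      k * Q         ∎)
      where open ≤-Reasoning
    k+Q≤1+kr : k + Q ≤ 1 + k * r
    k+Q≤1+kr = +-cancelʳ-≤ (t * Q) (k + Q) (1 + k * r) (begin
      k + Q + t * Q       ≡⟨ +-assoc k Q (t * Q) ⟩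
      k + suc t * Q       ≤⟨ +-monoʳ-≤ k (*-monoˡ-≤ Q t<k) ⟩
      k + k * Q           ≤⟨ +-monoʳ-≤ k (*-monoʳ-≤ k Q≤r+β) ⟩
      k + k * (r + β′)    ≡⟨ expand k r β′ ⟩
      k * (1 + β′) + k * r ≡⟨ cong (_+ k * r) k[1+β]≡1+tQ ⟩
      1 + t * Q + k * r   ≡⟨ +-right-comm 1 (t * Q) (k * r) ⟩
      1 + k * r + t * Q   ∎)
      where
      open ≤-Reasoning
      expand : ∀ k r β → k + k * (r + β) ≡ k * (1 + β) + k * r
      expand = solve-∀
    Q≤kr : Q ≤ k * r
    Q≤kr = ≤-pred (≤-trans (+-monoˡ-≤ Q (>-nonZero⁻¹ k)) k+Q≤1+kr)

  -- Telescoping carries-telescope from 0 to n: the carries of n below J are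
  -- ν_p(K(n)) − ν_p(n!), provided J ≥ nk bounds all the valuations involved.
  carries≡valuation-difference : ∀ J n → n * k ≤ J →
    Σ ℕ λ eK → Σ ℕ λ eF → IsValuation eK (numerator k n) × IsValuation eF (n !) × eK ≡ carries J n + eF
  carries≡valuation-difference J zero _ =
    0 , 0 , valuation-unit p∤1 , valuation-unit p∤1 , sym (trans (+-identityʳ _) (carries-zero J))
  carries≡valuation-difference J (suc n) [1+n]k≤J
    with carries≡valuation-difference J n (≤-trans (m≤n+m (n * k) k) [1+n]k≤J)
       | valuation-exists (1 + n * k) (s≤s z≤n) | valuation-exists (suc n) (s≤s z≤n)
  ... | eK , eF , valK , valF , eK≡ | e₁ , val₁ | e₂ , val₂ =
    eK + (0 + e₁) , e₂ + eF ,
    valuation-* valK (valuation-* (valuation-unit p∤k) val₁) , valuation-* val₂ valF , exponents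
    where
    1+nk≤J : 1 + n * k ≤ J
    1+nk≤J = ≤-trans (+-monoˡ-≤ (n * k) (>-nonZero⁻¹ k)) [1+n]k≤J
    1+n≤J : suc n ≤ J
    1+n≤J = ≤-trans (m≤m*n (suc n) k) [1+n]k≤J
    one-step : carries J n + e₁ ≡ carries J (suc n) + e₂
    one-step = begin
      carries J n + e₁                          ≡⟨ cong (carries J n +_) (count-prime-powers J val₁ (<⇒≤ (<-≤-trans (valuation-< val₁) 1+nk≤J))) ⟨
      carries J n + ν-trunc J (1 + n * k)       ≡⟨ carries-telescope J n ⟩
      carries J (suc n) + ν-trunc J (suc n)     ≡⟨ cong (carries J (suc n) +_) (count-prime-powers J val₂ (<⇒≤ (<-≤-trans (valuation-< val₂) 1+n≤J))) ⟩
      carries J (suc n) + e₂                    ∎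
      where open ≡-Reasoning
    exponents : eK + (0 + e₁) ≡ carries J (suc n) + (e₂ + eF)
    exponents = begin
      eK + e₁                         ≡⟨ cong (_+ e₁) eK≡ ⟩
      carries J n + eF + e₁           ≡⟨ +-right-comm (carries J n) eF e₁ ⟩
      carries J n + e₁ + eF           ≡⟨ cong (_+ eF) one-step ⟩
      carries J (suc n) + e₂ + eF     ≡⟨ +-assoc (carries J (suc n)) e₂ eF ⟩
      carries J (suc n) + (e₂ + eF)   ∎
      where open ≡-Reasoning

theorem3p7 : (k : ℕ) .{{_ : NonZero k}} (p : ℕ) .{{_ : NonZero p}} → Prime p → ¬ (p ∣ k) →
    (b : ℕ → ℕ) → (∀ m → b m < p) →
    (∀ M → p ^ M ∣ (k * (1 + sumBelow M (λ m → b m * p ^ m)) ∸ 1)) →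
    (n : ℕ) →
    Σ ℕ λ B → (∀ m → condM p (digit p n) b m ≡ true → m < B) ×
      ValP p (countBelow B (condM p (digit p n) b)) (c n k)
theorem3p7 k p p-prime p∤k b b<p hyp n =
  k * n , conditions-below-kn , subst (λ N → ValP p N (c n k)) (sym conditions≡carries) carries-are-valuation
  where
  open Valuation p-prime
  open Carries k p p-prime p∤k b b<p hyp
  conditions-below-kn : ∀ m → condM p (digit p n) b m ≡ true → m < k * n
  conditions-below-kn m holds = carry⇒m<kn n m (trans (sym (condM≡carry n m)) holds)
  conditions≡carries : countBelow (k * n) (condM p (digit p n) b) ≡ carries (k * n) n
  conditions≡carries = countBelow-cong (k * n) (λ m _ → condM≡carry n m)
  carries-are-valuation : ValP p (carries (k * n) n) (c n k)
  carries-are-valuation with carries≡valuation-difference (k * n) n (≤-reflexive (*-comm n k))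
  ... | eK , eF , valK , valF , eK≡ =
    ValP-from-product (c n k) (c·n!≡numerator k n) (subst (λ e → IsValuation e _) eK≡ valK) valF
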